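{- Let $n,m\in\mathbb{N}$ and let $B_n$ be the full subgraph of $C_n$ on the $n+1$ vertices consisting of the origin $00\cdots0$ and the $n$ vertices with exactly one coordinate equal to $1$, with inclusion $i:B_n\hookrightarrow C_n$. Then the map sending a join-preserving graph morphism $g:C_n\to C_m$ to its restriction $g\circ i:B_n\to C_m$ is a bijection between the set of join-preserving graph morphisms $C_n\to C_m$ and the set of all graph morphisms $B_n\to C_m$. Moreover, a join-preserving $g$ preserves meets if and only if $g\circ i$ preserves meets (i.e. whenever $u\wedge v$ exists in the preorder $B_n^*$, $g(u\wedge v)=g(u)\wedge g(v)$ in $C_m^*$).
   Context: A graph is a pair $(V,E)$ with $E\subseteq V\times V$; a full subgraph on $W\subseteq V$ is $(W,E\cap(W\times W))$. A graph morphism $(V,E)\to(V',E')$ is a function $f:V\to V'$ such that $(s,t)\in E$ implies $(f(s),f(t))\in E'$. For a graph $G$, $G^*$ is the preorder on its vertices with $u\le v$ iff there is a directed chain of edges from $u$ to $v$; meets and joins refer to greatest lower and least upper bounds in this preorder. The standard $n$-cube graph $C_n$ has vertex set $\{0,1\}^n$ and edges: a loop at every vertex, and an edge $(u,v)$ whenever $u,v$ differ in exactly one coordinate $i$ with $u_i=0$, $v_i=1$. In $C_n^*$ (coordinatewise order) binary meets and joins always exist (coordinatewise min and max). A graph morphism $g:C_n\to C_m$ preserves joins (resp. meets) if $g(u\vee v)=g(u)\vee g(v)$ (resp. $g(u\wedge v)=g(u)\wedge g(v)$) for all vertices $u,v$. -}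

module Defs where

open import Data.Nat using (ℕ)
open import Data.Bool using (Bool; true; false; _∧_; _∨_)
open import Data.Fin using (Fin)
open import Data.Vec using (Vec; lookup; replicate; zipWith)
open import Data.Product using (Σ; _×_; proj₁)
open import Data.Sum using (_⊎_)
open import Relation.Binary.PropositionalEquality using (_≡_; _≢_)
open import Relation.Binary.Construct.Closure.ReflexiveTransitive using (Star)

record Graph : Set₁ where
  field
    V : Set
    E : V → V → Set
open Graph public

IsMorphism : (G H : Graph) → (V G → V H) → Set
IsMorphism G H f = ∀ s t → E G s t → E H (f s) (f t)

record Morphism (G H : Graph) : Set where
  field
    fun : V G → V H
    mor : IsMorphism G H fun
open Morphism public

_⊢_≤_ : (G : Graph) → V G → V G → Set
G ⊢ u ≤ v = Star (E G) u v

IsMeet : (G : Graph) → V G → V G → V G → Set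
IsMeet G u v w = (G ⊢ w ≤ u) × (G ⊢ w ≤ v) ×
  (∀ z → G ⊢ z ≤ u → G ⊢ z ≤ v → G ⊢ z ≤ w)

data CEdge {n : ℕ} : Vec Bool n → Vec Bool n → Set where
  loop : ∀ u → CEdge u u
  step : ∀ u v (i : Fin n) →
         lookup u i ≡ false → lookup v i ≡ true →
         (∀ j → j ≢ i → lookup u j ≡ lookup v j) → CEdge u v

C : ℕ → Graph
C n = record { V = Vec Bool n ; E = CEdge }

_⊔_ : ∀ {n} → Vec Bool n → Vec Bool n → Vec Bool n
u ⊔ v = zipWith _∨_ u v

_⊓_ : ∀ {n} → Vec Bool n → Vec Bool n → Vec Bool n
u ⊓ v = zipWith _∧_ u v

IsBVertex : ∀ {n} → Vec Bool n → Set
IsBVertex {n} v = (v ≡ replicate n false) ⊎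
  Σ (Fin n) (λ i → (lookup v i ≡ true) × (∀ j → j ≢ i → lookup v j ≡ false))

BVert : ℕ → Set
BVert n = Σ (Vec Bool n) IsBVertex

B : ℕ → Graph
B n = record { V = BVert n ; E = λ u v → CEdge (proj₁ u) (proj₁ v) }

incl : ∀ {n} → BVert n → Vec Bool n
incl = proj₁

PreservesJoins : ∀ {n m} → (Vec Bool n → Vec Bool m) → Set
PreservesJoins g = ∀ u v → g (u ⊔ v) ≡ g u ⊔ g v

PreservesMeets : ∀ {n m} → (Vec Bool n → Vec Bool m) → Set
PreservesMeets g = ∀ u v → g (u ⊓ v) ≡ g u ⊓ g v

BPreservesMeets : ∀ {n m} → (BVert n → Vec Bool m) → Set
BPreservesMeets {n} h = ∀ u v w → IsMeet (B n) u v w → h w ≡ h u ⊓ h v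

record JoinMorphism (n m : ℕ) : Set where
  field
    jfun  : Vec Bool n → Vec Bool m
    jmor  : IsMorphism (C n) (C m) jfun
    joins : PreservesJoins jfun
open JoinMorphism public

restrict : ∀ {n m} → JoinMorphism n m → Morphism (B n) (C m)
restrict {n} g = record
  { fun = λ x → jfun g (incl x)
  ; mor = λ s t e → jmor g (incl s) (incl t) e }

-- Read vertices of C_n as subsets of Fin n, so that ⊔ and ⊓ become ∪ and ∩, the
-- origin becomes ⊥ and the other vertices of B_n become the singletons ⁅ i ⁆.
-- Every u is the union of the ⁅ i ⁆ with i ∈ u, so a join-preserving g satisfies
-- g u = g ⊥ ∪ ⋃_{i ∈ u} g ⁅ i ⁆: it is determined by g ∘ incl, and conversely any
-- morphism h on B_n extends by this formula, because an edge of C_n adds a single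
-- ⁅ i ⁆ and h maps the edge ⊥ → ⁅ i ⁆ of B_n to an edge. Writing x ∈ g u as
-- "x ∈ g ⊥ or x ∈ g ⁅ i ⁆ for some i ∈ u", g preserves meets exactly when
-- g ⁅ i ⁆ ∩ g ⁅ j ⁆ ⊆ g ⊥ for i ≢ j, which is the statement that g ∘ incl sends
-- the meet ⊥ of ⁅ i ⁆ and ⁅ j ⁆ in B_n to a meet.
module Submission where

open import Defs
open import Data.Nat using (ℕ)
open import Data.Bool using (true; false; _∨_)
open import Data.Bool.Properties using (¬-not; ∨-identityʳ)
open import Data.Fin using (Fin; zero; suc; _≟_)
open import Data.Fin.Subset using (Subset; ⊥; ⁅_⁆; _∈_; _∉_; _⊆_; _∪_; _∩_; inside; outside)
open import Data.Fin.Subset.Properties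
  using ( _∈?_; ∉⊥; ⊥⊆; Empty-unique; x∈⁅x⁆; x∈⁅y⁆⇒x≡y; x≢y⇒x∉⁅y⁆
        ; ⊆-reflexive; ⊆-trans; ⊆-antisym
        ; p∩q⊆p; p∩q⊆q; x∈p∩q⁺; x∈p∩q⁻; p⊆p∪q; q⊆p∪q; x∈p∪q⁺; x∈p∪q⁻
        ; ∪-assoc; ∪-comm; ∪-identityˡ; ∪-identityʳ; ∪-idempotentCommutativeMonoid )
open import Data.Vec using ([]; _∷_; lookup; here; there)
open import Data.Vec.Properties using (lookup-zipWith; []=⇒lookup; lookup⇒[]=)
open import Data.Product using (Σ; ∃-syntax; _×_; _,_; proj₂)
open import Data.Sum using (_⊎_; inj₁; inj₂; [_,_]′)
open import Function using (_∘_; id)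
open import Function.Bundles using (_⇔_; mk⇔)
open import Relation.Nullary using (yes; no; contradiction)
open import Relation.Binary.PropositionalEquality
open import Relation.Binary.Construct.Closure.ReflexiveTransitive using (ε; _◅_)
import Algebra.Properties.IdempotentCommutativeMonoid as ICM

private
  variable
    k n m : ℕ

∉⇒lookup≡false : {i : Fin n} {p : Subset n} → i ∉ p → lookup p i ≡ false
∉⇒lookup≡false {i = i} {p} i∉p = ¬-not (i∉p ∘ lookup⇒[]= i p)

lookup≡false⇒∉ : {i : Fin n} {p : Subset n} → lookup p i ≡ false → i ∉ p
lookup≡false⇒∉ pᵢ≡false i∈p = contradiction (trans (sym ([]=⇒lookup i∈p)) pᵢ≡false) λ ()

x∈p⇒⁅x⁆⊆p : {i : Fin n} {p : Subset n} → i ∈ p → ⁅ i ⁆ ⊆ p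
x∈p⇒⁅x⁆⊆p {i = i} {p} i∈p x∈⁅i⁆ = subst (_∈ p) (sym (x∈⁅y⁆⇒x≡y i x∈⁅i⁆)) i∈p

p⊆q⇒p∪q≡q : {p q : Subset n} → p ⊆ q → p ∪ q ≡ q
p⊆q⇒p∪q≡q {p = p} {q} p⊆q = ⊆-antisym (λ x∈ → [ p⊆q , id ]′ (x∈p∪q⁻ p q x∈)) (q⊆p∪q p q)

p⊆⁅x⁆⇒p≡⊥⊎p≡⁅x⁆ : {p : Subset n} {i : Fin n} → p ⊆ ⁅ i ⁆ → p ≡ ⊥ ⊎ p ≡ ⁅ i ⁆
p⊆⁅x⁆⇒p≡⊥⊎p≡⁅x⁆ {p = p} {i} p⊆⁅i⁆ with i ∈? p
... | yes i∈p = inj₂ (⊆-antisym p⊆⁅i⁆ (x∈p⇒⁅x⁆⊆p i∈p))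
... | no i∉p = inj₁ (Empty-unique λ (x , x∈p) →
  i∉p (subst (_∈ p) (x∈⁅y⁆⇒x≡y i (p⊆⁅i⁆ x∈p)) x∈p))

x≢y⇒⁅x⁆∩⁅y⁆≡⊥ : {i j : Fin n} → i ≢ j → ⁅ i ⁆ ∩ ⁅ j ⁆ ≡ ⊥
x≢y⇒⁅x⁆∩⁅y⁆≡⊥ {i = i} {j} i≢j = Empty-unique λ (x , x∈) →
  let x∈⁅i⁆ , x∈⁅j⁆ = x∈p∩q⁻ ⁅ i ⁆ ⁅ j ⁆ x∈
  in i≢j (trans (sym (x∈⁅y⁆⇒x≡y i x∈⁅i⁆)) (x∈⁅y⁆⇒x≡y j x∈⁅j⁆))

⋃⟨_⟩ : (Fin k → Subset m) → Subset k → Subset m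
⋃⟨ a ⟩ []            = ⊥
⋃⟨ a ⟩ (inside ∷ u)  = ⋃⟨ a ∘ suc ⟩ u ∪ a zero
⋃⟨ a ⟩ (outside ∷ u) = ⋃⟨ a ∘ suc ⟩ u

∈⋃⟨⟩⁺ : (a : Fin k → Subset m) {u : Subset k} {i : Fin k} {x : Fin m} →
  i ∈ u → x ∈ a i → x ∈ ⋃⟨ a ⟩ u
∈⋃⟨⟩⁺ a {inside ∷ u}  here        x∈aᵢ = x∈p∪q⁺ (inj₂ x∈aᵢ)
∈⋃⟨⟩⁺ a {inside ∷ u}  (there i∈u) x∈aᵢ = x∈p∪q⁺ (inj₁ (∈⋃⟨⟩⁺ (a ∘ suc) i∈u x∈aᵢ))
∈⋃⟨⟩⁺ a {outside ∷ u} (there i∈u) x∈aᵢ = ∈⋃⟨⟩⁺ (a ∘ suc) i∈u x∈aᵢ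

∈⋃⟨⟩⁻ : (a : Fin k → Subset m) (u : Subset k) {x : Fin m} →
  x ∈ ⋃⟨ a ⟩ u → ∃[ i ] i ∈ u × x ∈ a i
∈⋃⟨⟩⁻ a [] x∈ = contradiction x∈ ∉⊥
∈⋃⟨⟩⁻ a (inside ∷ u) x∈ with x∈p∪q⁻ (⋃⟨ a ∘ suc ⟩ u) (a zero) x∈
... | inj₂ x∈a₀ = zero , here , x∈a₀
... | inj₁ x∈⋃ = let i , i∈u , x∈aᵢ = ∈⋃⟨⟩⁻ (a ∘ suc) u x∈⋃ in suc i , there i∈u , x∈aᵢ
∈⋃⟨⟩⁻ a (outside ∷ u) x∈ =
  let i , i∈u , x∈aᵢ = ∈⋃⟨⟩⁻ (a ∘ suc) u x∈ in suc i , there i∈u , x∈aᵢ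

⋃⟨⟩-⊥ : (a : Fin k → Subset m) → ⋃⟨ a ⟩ ⊥ ≡ ⊥
⋃⟨⟩-⊥ a = Empty-unique λ (x , x∈) → let _ , i∈⊥ , _ = ∈⋃⟨⟩⁻ a ⊥ x∈ in ∉⊥ i∈⊥

⋃⟨⟩-⁅⁆ : (a : Fin k → Subset m) (i : Fin k) → ⋃⟨ a ⟩ ⁅ i ⁆ ≡ a i
⋃⟨⟩-⁅⁆ a zero    = trans (cong (_∪ a zero) (⋃⟨⟩-⊥ (a ∘ suc))) (∪-identityˡ (a zero))
⋃⟨⟩-⁅⁆ a (suc i) = ⋃⟨⟩-⁅⁆ (a ∘ suc) i

⋃⟨⁅⁆⟩ : (u : Subset n) → ⋃⟨ ⁅_⁆ ⟩ u ≡ u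
⋃⟨⁅⁆⟩ u = ⊆-antisym ⋃⊆u (λ {x} x∈u → ∈⋃⟨⟩⁺ ⁅_⁆ x∈u (x∈⁅x⁆ x))
  where
  ⋃⊆u : ⋃⟨ ⁅_⁆ ⟩ u ⊆ u
  ⋃⊆u x∈ = let i , i∈u , x∈⁅i⁆ = ∈⋃⟨⟩⁻ ⁅_⁆ u x∈ in x∈p⇒⁅x⁆⊆p i∈u x∈⁅i⁆

⋃⟨⟩-∪ : (a : Fin k → Subset m) (u v : Subset k) → ⋃⟨ a ⟩ (u ∪ v) ≡ ⋃⟨ a ⟩ u ∪ ⋃⟨ a ⟩ v
⋃⟨⟩-∪ a u v = ⊆-antisym ⊆∪ ∪⊆
  where
  ⊆∪ : ⋃⟨ a ⟩ (u ∪ v) ⊆ ⋃⟨ a ⟩ u ∪ ⋃⟨ a ⟩ v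
  ⊆∪ x∈ with ∈⋃⟨⟩⁻ a (u ∪ v) x∈
  ... | i , i∈u∪v , x∈aᵢ =
    x∈p∪q⁺ ([ (λ i∈u → inj₁ (∈⋃⟨⟩⁺ a i∈u x∈aᵢ)) , (λ i∈v → inj₂ (∈⋃⟨⟩⁺ a i∈v x∈aᵢ)) ]′
            (x∈p∪q⁻ u v i∈u∪v))
  ∪⊆ : ⋃⟨ a ⟩ u ∪ ⋃⟨ a ⟩ v ⊆ ⋃⟨ a ⟩ (u ∪ v)
  ∪⊆ x∈ with x∈p∪q⁻ (⋃⟨ a ⟩ u) (⋃⟨ a ⟩ v) x∈
  ... | inj₁ x∈⋃u = let i , i∈u , x∈aᵢ = ∈⋃⟨⟩⁻ a u x∈⋃u in ∈⋃⟨⟩⁺ a (p⊆p∪q v i∈u) x∈aᵢ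
  ... | inj₂ x∈⋃v = let i , i∈v , x∈aᵢ = ∈⋃⟨⟩⁻ a v x∈⋃v in ∈⋃⟨⟩⁺ a (q⊆p∪q u v i∈v) x∈aᵢ

⋃⟨⟩-cong : {a b : Fin k → Subset m} → (∀ i → a i ≡ b i) → ∀ u → ⋃⟨ a ⟩ u ≡ ⋃⟨ b ⟩ u
⋃⟨⟩-cong a≗b []            = refl
⋃⟨⟩-cong a≗b (inside ∷ u)  = cong₂ _∪_ (⋃⟨⟩-cong (a≗b ∘ suc) u) (a≗b zero)
⋃⟨⟩-cong a≗b (outside ∷ u) = ⋃⟨⟩-cong (a≗b ∘ suc) u

step⇒≡∪⁅⁆ : {u v : Subset n} {i : Fin n} → lookup v i ≡ true →
  (∀ j → j ≢ i → lookup u j ≡ lookup v j) → v ≡ u ∪ ⁅ i ⁆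
step⇒≡∪⁅⁆ {u = u} {v} {i} vᵢ uⱼ≡vⱼ = ⊆-antisym v⊆ ⊆v
  where
  v⊆ : v ⊆ u ∪ ⁅ i ⁆
  v⊆ {j} j∈v with j ≟ i
  ... | yes refl = x∈p∪q⁺ (inj₂ (x∈⁅x⁆ i))
  ... | no j≢i   = x∈p∪q⁺ (inj₁ (lookup⇒[]= j u (trans (uⱼ≡vⱼ j j≢i) ([]=⇒lookup j∈v))))
  ⊆v : u ∪ ⁅ i ⁆ ⊆ v
  ⊆v {j} j∈ with j ≟ i
  ... | yes refl = lookup⇒[]= i v vᵢ
  ... | no j≢i   =
    let j∈u = [ id , (λ j∈⁅i⁆ → contradiction j∈⁅i⁆ (x≢y⇒x∉⁅y⁆ j≢i)) ]′ (x∈p∪q⁻ u ⁅ i ⁆ j∈)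
    in lookup⇒[]= j v (trans (sym (uⱼ≡vⱼ j j≢i)) ([]=⇒lookup j∈u))

CEdge-∪⁅⁆ : (u : Subset n) (i : Fin n) → CEdge u (u ∪ ⁅ i ⁆)
CEdge-∪⁅⁆ u i with i ∈? u
... | yes i∈u = subst (CEdge u) (sym (trans (∪-comm u ⁅ i ⁆) (p⊆q⇒p∪q≡q (x∈p⇒⁅x⁆⊆p i∈u)))) (loop u)
... | no i∉u  = step u (u ∪ ⁅ i ⁆) i (∉⇒lookup≡false i∉u)
  ([]=⇒lookup (q⊆p∪q u ⁅ i ⁆ (x∈⁅x⁆ i)))
  λ j j≢i → sym (begin
    lookup (u ∪ ⁅ i ⁆) j      ≡⟨ lookup-zipWith _∨_ j u ⁅ i ⁆ ⟩
    lookup u j ∨ lookup ⁅ i ⁆ j ≡⟨ cong (lookup u j ∨_) (∉⇒lookup≡false (x≢y⇒x∉⁅y⁆ j≢i)) ⟩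
    lookup u j ∨ false         ≡⟨ ∨-identityʳ (lookup u j) ⟩
    lookup u j                 ∎)
  where open ≡-Reasoning

CEdge⇒⊆ : {u v : Subset n} → CEdge u v → u ⊆ v
CEdge⇒⊆ (loop u) = id
CEdge⇒⊆ (step u v i _ vᵢ uⱼ≡vⱼ) = subst (u ⊆_) (sym (step⇒≡∪⁅⁆ vᵢ uⱼ≡vⱼ)) (p⊆p∪q ⁅ i ⁆)

CEdge-∪ˡ : (w : Subset n) {u v : Subset n} → CEdge u v → CEdge (w ∪ u) (w ∪ v)
CEdge-∪ˡ w (loop u) = loop (w ∪ u)
CEdge-∪ˡ w (step u v i _ vᵢ uⱼ≡vⱼ) =
  subst (CEdge (w ∪ u)) (trans (∪-assoc w u ⁅ i ⁆) (cong (w ∪_) (sym (step⇒≡∪⁅⁆ vᵢ uⱼ≡vⱼ))))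
    (CEdge-∪⁅⁆ (w ∪ u) i)

IsBVertex-⊥ : IsBVertex (⊥ {n})
IsBVertex-⊥ = inj₁ refl

IsBVertex-⁅⁆ : (i : Fin n) → IsBVertex ⁅ i ⁆
IsBVertex-⁅⁆ i = inj₂ (i , []=⇒lookup (x∈⁅x⁆ i) , λ j j≢i → ∉⇒lookup≡false (x≢y⇒x∉⁅y⁆ j≢i))

IsBVertex⇒≡⊥⊎≡⁅⁆ : {v : Subset n} → IsBVertex v → v ≡ ⊥ ⊎ ∃[ i ] v ≡ ⁅ i ⁆
IsBVertex⇒≡⊥⊎≡⁅⁆ (inj₁ v≡⊥) = inj₁ v≡⊥
IsBVertex⇒≡⊥⊎≡⁅⁆ {v = v} (inj₂ (i , vᵢ , vⱼ)) = inj₂ (i , ⊆-antisym v⊆⁅i⁆ (x∈p⇒⁅x⁆⊆p (lookup⇒[]= i v vᵢ)))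
  where
  v⊆⁅i⁆ : v ⊆ ⁅ i ⁆
  v⊆⁅i⁆ {j} j∈v with j ≟ i
  ... | yes refl = x∈⁅x⁆ i
  ... | no j≢i   = contradiction j∈v (lookup≡false⇒∉ (vⱼ j j≢i))

⊆-IsBVertex⇒≡⊥⊎≡ : {p q : Subset n} → IsBVertex q → p ⊆ q → p ≡ ⊥ ⊎ p ≡ q
⊆-IsBVertex⇒≡⊥⊎≡ bq p⊆q with IsBVertex⇒≡⊥⊎≡⁅⁆ bq
... | inj₁ refl       = inj₁ (⊆-antisym p⊆q ⊥⊆)
... | inj₂ (i , refl) = p⊆⁅x⁆⇒p≡⊥⊎p≡⁅x⁆ p⊆q

IsBVertex-⊆ : {p q : Subset n} → p ⊆ q → IsBVertex q → IsBVertex p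
IsBVertex-⊆ p⊆q bq with ⊆-IsBVertex⇒≡⊥⊎≡ bq p⊆q
... | inj₁ refl = IsBVertex-⊥
... | inj₂ refl = bq

⊆⇒CEdge : {p q : Subset n} → IsBVertex q → p ⊆ q → CEdge p q
⊆⇒CEdge {q = q} bq p⊆q with ⊆-IsBVertex⇒≡⊥⊎≡ bq p⊆q | IsBVertex⇒≡⊥⊎≡⁅⁆ bq
... | inj₂ refl | _               = loop q
... | inj₁ refl | inj₁ refl       = loop ⊥
... | inj₁ refl | inj₂ (i , refl) = subst (CEdge ⊥) (∪-identityˡ ⁅ i ⁆) (CEdge-∪⁅⁆ ⊥ i)

⊥ᴮ : BVert n
⊥ᴮ = ⊥ , IsBVertex-⊥

⁅_⁆ᴮ : Fin n → BVert n
⁅ i ⁆ᴮ = ⁅ i ⁆ , IsBVertex-⁅⁆ i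

≤ᴮ⇒⊆ : {x y : BVert n} → B n ⊢ x ≤ y → incl x ⊆ incl y
≤ᴮ⇒⊆ ε        = id
≤ᴮ⇒⊆ (e ◅ x≤y) = ⊆-trans (CEdge⇒⊆ e) (≤ᴮ⇒⊆ x≤y)

⊆⇒≤ᴮ : {x y : BVert n} → incl x ⊆ incl y → B n ⊢ x ≤ y
⊆⇒≤ᴮ {y = y} x⊆y = ⊆⇒CEdge (proj₂ y) x⊆y ◅ ε

IsMeetᴮ⇒≡∩ : (u v w : BVert n) → IsMeet (B n) u v w → incl w ≡ incl u ∩ incl v
IsMeetᴮ⇒≡∩ u v w (w≤u , w≤v , greatest) = ⊆-antisym
  (λ x∈w → x∈p∩q⁺ (≤ᴮ⇒⊆ w≤u x∈w , ≤ᴮ⇒⊆ w≤v x∈w))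
  (≤ᴮ⇒⊆ (greatest u∩v (⊆⇒≤ᴮ (p∩q⊆p (incl u) (incl v))) (⊆⇒≤ᴮ (p∩q⊆q (incl u) (incl v)))))
  where
  u∩v : BVert _
  u∩v = incl u ∩ incl v , IsBVertex-⊆ (p∩q⊆p (incl u) (incl v)) (proj₂ u)

≡∩⇒IsMeetᴮ : (u v w : BVert n) → incl w ≡ incl u ∩ incl v → IsMeet (B n) u v w
≡∩⇒IsMeetᴮ u v w w≡u∩v =
    ⊆⇒≤ᴮ (⊆-trans w⊆u∩v (p∩q⊆p (incl u) (incl v)))
  , ⊆⇒≤ᴮ (⊆-trans w⊆u∩v (p∩q⊆q (incl u) (incl v)))
  , λ z z≤u z≤v →
      ⊆⇒≤ᴮ (⊆-trans (λ x∈z → x∈p∩q⁺ (≤ᴮ⇒⊆ z≤u x∈z , ≤ᴮ⇒⊆ z≤v x∈z)) (⊆-reflexive (sym w≡u∩v)))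
  where
  w⊆u∩v : incl w ⊆ incl u ∩ incl v
  w⊆u∩v = ⊆-reflexive w≡u∩v

fun-cong-incl : (h : Morphism (B n) (C m)) {b b′ : BVert n} → incl b ≡ incl b′ → fun h b ≡ fun h b′
fun-cong-incl h {b} {b′} b≡b′ = ⊆-antisym
  (CEdge⇒⊆ (mor h b b′ (subst (CEdge (incl b)) b≡b′ (loop (incl b)))))
  (CEdge⇒⊆ (mor h b′ b (subst (CEdge (incl b′)) (sym b≡b′) (loop (incl b′)))))

module JoinPreserving {G : Subset n → Subset m} (G-∪ : PreservesJoins G) where

  G-⋃⟨⟩ : (a : Fin k → Subset n) (u : Subset k) → G (⋃⟨ a ⟩ u) ≡ G ⊥ ∪ ⋃⟨ G ∘ a ⟩ u
  G-⋃⟨⟩ a []            = sym (∪-identityʳ (G ⊥))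
  G-⋃⟨⟩ a (outside ∷ u) = G-⋃⟨⟩ (a ∘ suc) u
  G-⋃⟨⟩ a (inside ∷ u)  = begin
    G (⋃⟨ a ∘ suc ⟩ u ∪ a zero)              ≡⟨ G-∪ (⋃⟨ a ∘ suc ⟩ u) (a zero) ⟩
    G (⋃⟨ a ∘ suc ⟩ u) ∪ G (a zero)           ≡⟨ cong (_∪ G (a zero)) (G-⋃⟨⟩ (a ∘ suc) u) ⟩
    (G ⊥ ∪ ⋃⟨ G ∘ a ∘ suc ⟩ u) ∪ G (a zero)   ≡⟨ ∪-assoc (G ⊥) _ (G (a zero)) ⟩
    G ⊥ ∪ ⋃⟨ G ∘ a ⟩ (inside ∷ u)            ∎
    where open ≡-Reasoning

  affine : (u : Subset n) → G u ≡ G ⊥ ∪ ⋃⟨ G ∘ ⁅_⁆ ⟩ u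
  affine u = trans (cong G (sym (⋃⟨⁅⁆⟩ u))) (G-⋃⟨⟩ ⁅_⁆ u)

  ∈G⁻ : (u : Subset n) {x : Fin m} → x ∈ G u → x ∈ G ⊥ ⊎ ∃[ i ] i ∈ u × x ∈ G ⁅ i ⁆
  ∈G⁻ u x∈ with x∈p∪q⁻ (G ⊥) (⋃⟨ G ∘ ⁅_⁆ ⟩ u) (subst (_ ∈_) (affine u) x∈)
  ... | inj₁ x∈G⊥ = inj₁ x∈G⊥
  ... | inj₂ x∈⋃  = inj₂ (∈⋃⟨⟩⁻ (G ∘ ⁅_⁆) u x∈⋃)

  monotone : {p q : Subset n} → p ⊆ q → G p ⊆ G q
  monotone {p} {q} p⊆q x∈ =
    subst (_ ∈_) (trans (sym (G-∪ p q)) (cong G (p⊆q⇒p∪q≡q p⊆q))) (x∈p∪q⁺ (inj₁ x∈))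

  isMorphism : (∀ i → CEdge (G ⊥) (G ⁅ i ⁆)) → IsMorphism (C n) (C m) G
  isMorphism edge-⊥⁅⁆ _ _ (loop u) = loop (G u)
  isMorphism edge-⊥⁅⁆ _ _ (step u v i _ vᵢ uⱼ≡vⱼ) =
    subst₂ CEdge (trans (sym (G-∪ u ⊥)) (cong G (∪-identityʳ u)))
                 (trans (sym (G-∪ u ⁅ i ⁆)) (cong G (sym (step⇒≡∪⁅⁆ vᵢ uⱼ≡vⱼ))))
      (CEdge-∪ˡ (G u) (edge-⊥⁅⁆ i))

  preservesMeets : (∀ i j → i ≢ j → G ⁅ i ⁆ ∩ G ⁅ j ⁆ ⊆ G ⊥) → PreservesMeets G
  preservesMeets disjoint u v = ⊆-antisym ⊆∩ ∩⊆
    where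
    ⊆∩ : G (u ∩ v) ⊆ G u ∩ G v
    ⊆∩ x∈ = x∈p∩q⁺ (monotone (p∩q⊆p u v) x∈ , monotone (p∩q⊆q u v) x∈)
    ∩⊆ : G u ∩ G v ⊆ G (u ∩ v)
    ∩⊆ x∈ with x∈p∩q⁻ (G u) (G v) x∈
    ... | x∈Gu , x∈Gv with ∈G⁻ u x∈Gu | ∈G⁻ v x∈Gv
    ... | inj₁ x∈G⊥ | _         = monotone ⊥⊆ x∈G⊥
    ... | inj₂ _    | inj₁ x∈G⊥ = monotone ⊥⊆ x∈G⊥
    ... | inj₂ (i , i∈u , x∈Gᵢ) | inj₂ (j , j∈v , x∈Gⱼ) with i ≟ j
    ...   | yes refl = monotone (x∈p⇒⁅x⁆⊆p (x∈p∩q⁺ (i∈u , j∈v))) x∈Gᵢ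
    ...   | no i≢j   = monotone ⊥⊆ (disjoint i j i≢j (x∈p∩q⁺ (x∈Gᵢ , x∈Gⱼ)))

open JoinPreserving using (affine; isMorphism; preservesMeets)

module Extension (h : Morphism (B n) (C m)) where

  a : Fin n → Subset m
  a i = fun h ⁅ i ⁆ᴮ

  ext : Subset n → Subset m
  ext u = fun h ⊥ᴮ ∪ ⋃⟨ a ⟩ u

  ext-∪ : PreservesJoins ext
  ext-∪ u v = trans (cong (fun h ⊥ᴮ ∪_) (⋃⟨⟩-∪ a u v))
    (ICM.∙-distrˡ-∙ (∪-idempotentCommutativeMonoid _) (fun h ⊥ᴮ) (⋃⟨ a ⟩ u) (⋃⟨ a ⟩ v))

  ext-⊥ : ext ⊥ ≡ fun h ⊥ᴮ
  ext-⊥ = trans (cong (fun h ⊥ᴮ ∪_) (⋃⟨⟩-⊥ a)) (∪-identityʳ (fun h ⊥ᴮ))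

  edge-⊥⁅⁆ : (i : Fin n) → CEdge (fun h ⊥ᴮ) (a i)
  edge-⊥⁅⁆ i = mor h ⊥ᴮ ⁅ i ⁆ᴮ (⊆⇒CEdge (IsBVertex-⁅⁆ i) ⊥⊆)

  ext-⁅⁆ : (i : Fin n) → ext ⁅ i ⁆ ≡ a i
  ext-⁅⁆ i = trans (cong (fun h ⊥ᴮ ∪_) (⋃⟨⟩-⁅⁆ a i)) (p⊆q⇒p∪q≡q (CEdge⇒⊆ (edge-⊥⁅⁆ i)))

  ext-incl : (b : BVert n) → ext (incl b) ≡ fun h b
  ext-incl b with IsBVertex⇒≡⊥⊎≡⁅⁆ (proj₂ b)
  ... | inj₁ b≡⊥         = trans (cong ext b≡⊥) (trans ext-⊥ (fun-cong-incl h (sym b≡⊥)))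
  ... | inj₂ (i , b≡⁅i⁆) = trans (cong ext b≡⁅i⁆) (trans (ext-⁅⁆ i) (fun-cong-incl h (sym b≡⁅i⁆)))

  extension : JoinMorphism n m
  extension = record
    { jfun  = ext
    ; jmor  = isMorphism ext-∪ λ i → subst₂ CEdge (sym ext-⊥) (sym (ext-⁅⁆ i)) (edge-⊥⁅⁆ i)
    ; joins = ext-∪
    }

open Extension using (extension; ext-incl)

restrict-injective : (g g′ : JoinMorphism n m) →
  fun (restrict g) ≗ fun (restrict g′) → jfun g ≗ jfun g′
restrict-injective g g′ g∘incl≗g′∘incl u = begin
  jfun g u                                ≡⟨ affine (joins g) u ⟩
  jfun g ⊥ ∪ ⋃⟨ jfun g ∘ ⁅_⁆ ⟩ u         ≡⟨ cong₂ _∪_ (g∘incl≗g′∘incl ⊥ᴮ)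
                                              (⋃⟨⟩-cong (g∘incl≗g′∘incl ∘ ⁅_⁆ᴮ) u) ⟩
  jfun g′ ⊥ ∪ ⋃⟨ jfun g′ ∘ ⁅_⁆ ⟩ u       ≡⟨ affine (joins g′) u ⟨
  jfun g′ u                               ∎
  where open ≡-Reasoning

preservesMeets⇔restrict : (g : JoinMorphism n m) →
  PreservesMeets (jfun g) ⇔ BPreservesMeets (fun (restrict g))
preservesMeets⇔restrict g = mk⇔
  (λ g-∩ u v w w-meet → trans (cong (jfun g) (IsMeetᴮ⇒≡∩ u v w w-meet)) (g-∩ (incl u) (incl v)))
  (λ g∘incl-∩ → preservesMeets (joins g) λ i j i≢j → ⊆-reflexive (sym
    (g∘incl-∩ ⁅ i ⁆ᴮ ⁅ j ⁆ᴮ ⊥ᴮ (≡∩⇒IsMeetᴮ ⁅ i ⁆ᴮ ⁅ j ⁆ᴮ ⊥ᴮ (sym (x≢y⇒⁅x⁆∩⁅y⁆≡⊥ i≢j))))))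

lemma2p12 : (n m : ℕ) →
    -- surjectivity of restriction
    ((h : Morphism (B n) (C m)) →
      Σ (JoinMorphism n m) (λ g → fun (restrict g) ≗ fun h))
    -- injectivity of restriction (functions compared pointwise)
    × ((g g′ : JoinMorphism n m) →
      fun (restrict g) ≗ fun (restrict g′) → jfun g ≗ jfun g′)
    -- meet preservation is detected on B_n
    × ((g : JoinMorphism n m) →
      PreservesMeets (jfun g) ⇔ BPreservesMeets (fun (restrict g)))
lemma2p12 n m =
    (λ h → extension h , ext-incl h)
  , restrict-injective
  , preservesMeets⇔restrict
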